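{- Let $n\ge4$ and $1<m<\binom n2$. If $G$ is a graph on $n$ vertices with $m$ edges such that the subgraph induced by its non-isolated vertices is complete, then $\theta(G)\neq\Theta_n(m)$.
   Context: All graphs are finite, simple and undirected. A clique cover of $G=(V,E)$ is a family of vertex sets, each inducing a clique, whose union is $V$ and such that every edge lies in some member. $\theta(G)$ is the minimum size of a clique cover of $G$. For $0\le m\le\binom n2$, $\Theta_n(m)$ is the maximum of $\theta(G)$ over all graphs $G$ with $n$ vertices and $m$ edges. -}

module Defs where

open import Data.Nat using (ℕ; _≤_; _<ᵇ_)
open import Data.Bool using (Bool; true; false; _∧_)
open import Data.Fin using (Fin; toℕ)
open import Data.Fin.Subset using (Subset; _∈_)
open import Data.Vec using (Vec; lookup)
open import Data.List using (List; length; filterᵇ; concatMap; map; allFin)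
open import Data.Product using (Σ; ∃; _×_; _,_)
open import Relation.Binary.PropositionalEquality using (_≡_; _≢_)

record Graph (n : ℕ) : Set where
  field
    adj    : Fin n → Fin n → Bool
    sym    : ∀ i j → adj i j ≡ adj j i
    irrefl : ∀ i → adj i i ≡ false
open Graph public

pairs : (n : ℕ) → List (Fin n × Fin n)
pairs n = concatMap (λ i → map (λ j → (i , j)) (allFin n)) (allFin n)

edgeCount : ∀ {n} → Graph n → ℕ
edgeCount {n} G = length (filterᵇ (λ p → test p) (pairs n))
  where
  test : Fin n × Fin n → Bool
  test (i , j) = (toℕ i <ᵇ toℕ j) ∧ adj G i j

IsClique : ∀ {n} → Graph n → Subset n → Set
IsClique G S = ∀ i j → i ∈ S → j ∈ S → i ≢ j → adj G i j ≡ true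

IsCliqueCover : ∀ {n k} → Graph n → Vec (Subset n) k → Set
IsCliqueCover {n} {k} G C =
  (∀ (l : Fin k) → IsClique G (lookup C l)) ×
  (∀ (v : Fin n) → ∃ λ (l : Fin k) → v ∈ lookup C l) ×
  (∀ (u v : Fin n) → adj G u v ≡ true →
     ∃ λ (l : Fin k) → u ∈ lookup C l × v ∈ lookup C l)

HasCliqueCoverOfSize : ∀ {n} → Graph n → ℕ → Set
HasCliqueCoverOfSize {n} G k = Σ (Vec (Subset n) k) (IsCliqueCover G)

IsTheta : ∀ {n} → Graph n → ℕ → Set
IsTheta G k = HasCliqueCoverOfSize G k × (∀ j → HasCliqueCoverOfSize G j → k ≤ j)

IsBigTheta : ℕ → ℕ → ℕ → Set
IsBigTheta n m t =
  (∃ λ (G : Graph n) → edgeCount G ≡ m × IsTheta G t) ×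
  (∀ (G : Graph n) k → edgeCount G ≡ m → IsTheta G k → k ≤ t)

NonIsolated : ∀ {n} → Graph n → Fin n → Set
NonIsolated G v = ∃ λ w → adj G v w ≡ true

NonIsolatedComplete : ∀ {n} → Graph n → Set
NonIsolatedComplete G =
  ∀ u v → NonIsolated G u → NonIsolated G v → u ≢ v → adj G u v ≡ true

-- Let K be the clique of non-isolated vertices of G and ℓ the number of isolated vertices, so that
-- θ(G) ≤ 1 + ℓ.  Since 1 < m < C(n,2), K has three vertices a, b, x and G has an isolated vertex c.
-- Moving the edge ab to ac gives a graph H with m edges in which the edges ax, bx and the ℓ vertices
-- isolated in G need pairwise different cliques, so Θ_n(m) ≥ θ(H) = 2 + ℓ > θ(G).

module Submission where

open import Defs hiding (sym)
open import Data.Nat using (ℕ; zero; suc; _+_; _≤_; _<_; _<ᵇ_; z≤n; s≤s)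
open import Data.Nat.Properties
  using (+-0-commutativeMonoid; +-comm; _<?_; <-irrefl; <-asym; <-trans; <-cmp; n<1+n; module ≤-Reasoning)
open import Algebra.Properties.CommutativeMonoid.Sum +-0-commutativeMonoid
  using (sum-syntax; sum-cong-≗; sum-replicate-zero; ∑-distrib-+)
open import Data.Nat.Combinatorics using (_C_; nC1≡n; nCk+nC[k+1]≡[n+1]C[k+1])
open import Data.Bool using (Bool; true; false; _∧_; _∨_; not; T?)
import Data.Bool.Properties as Bool
open import Data.Empty using (⊥-elim)
open import Data.Fin using (Fin; zero; suc; toℕ)
open import Data.Fin.Properties using (_≟_; any?; toℕ-injective; injective⇒≤)
open import Data.Fin.Subset using (Subset; _∈_)
open import Data.List
  using (List; []; _∷_; _++_; length; filter; filterᵇ; concatMap; map; tabulate; allFin; lookup)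
open import Data.List.Properties using (filter-++; length-++; map-tabulate)
open import Data.List.Membership.Propositional.Properties using (∈-filter⁺; ∈-allFin; ∈-lookup)
import Data.List.Relation.Unary.All as All
open import Data.List.Relation.Unary.All.Properties using (all-filter)
open import Data.List.Relation.Unary.Any using (index)
open import Data.List.Relation.Unary.Any.Properties using (lookup-index)
open import Data.List.Relation.Unary.AllPairs using (_∷_)
open import Data.List.Relation.Unary.Unique.Propositional using (Unique)
import Data.List.Relation.Unary.Unique.Propositional.Properties as Unique
import Data.Vec as Vec
import Data.Vec.Properties as Vec
open import Data.Product using (∃; ∃₂; _×_; _,_; proj₁; proj₂)
open import Data.Sum using (_⊎_; inj₁; inj₂; swap; [_,_])
import Data.Sum as Sum
open import Function using (_∘_; id; case_of_; Injective; mk⇔)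
open import Level using (0ℓ)
open import Relation.Binary.PropositionalEquality
  using (_≡_; _≢_; refl; sym; trans; cong; cong₂; subst; module ≡-Reasoning)
open import Relation.Nullary using (¬_; Dec; yes; no; does; ¬?; _×-dec_; _⊎-dec_)
open import Relation.Nullary.Decidable using (dec-true; dec-false; does-⇔; decidable-stable)
open import Relation.Unary using (Pred; Decidable)
open import Relation.Binary.Definitions using (tri<; tri≈; tri>)

iverson : Bool → ℕ
iverson false = 0
iverson true  = 1

count : {A : Set} → (A → Bool) → List A → ℕ
count p xs = length (filterᵇ p xs)

module _ {A : Set} (p : A → Bool) where

  count-∷ : ∀ x xs → count p (x ∷ xs) ≡ iverson (p x) + count p xs
  count-∷ x xs with p x
  ... | true  = refl
  ... | false = refl

  count-++ : ∀ xs ys → count p (xs ++ ys) ≡ count p xs + count p ys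
  count-++ xs ys = trans (cong length (filter-++ (T? ∘ p) xs ys)) (length-++ (filterᵇ p xs))

  count-positive : ∀ xs → 0 < count p xs → ∃ λ x → p x ≡ true
  count-positive (x ∷ xs) pos with p x in px
  ... | true  = x , px
  ... | false = count-positive xs pos

  count-tabulate : ∀ {n} (f : Fin n → A) → count p (tabulate f) ≡ ∑[ i < n ] iverson (p (f i))
  count-tabulate {zero}  f = refl
  count-tabulate {suc n} f =
    trans (count-∷ (f zero) _) (cong (iverson (p (f zero)) +_) (count-tabulate (f ∘ suc)))

  count-concatMap : ∀ {B : Set} {n} (g : B → List A) (f : Fin n → B) →
    count p (concatMap g (tabulate f)) ≡ ∑[ i < n ] count p (g (f i))
  count-concatMap {n = zero}  g f = refl
  count-concatMap {n = suc n} g f =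
    trans (count-++ (g (f zero)) _) (cong (count p (g (f zero)) +_) (count-concatMap g (f ∘ suc)))

count-pairs : ∀ {n} (p : Fin n × Fin n → Bool) →
  count p (pairs n) ≡ ∑[ i < n ] ∑[ j < n ] iverson (p (i , j))
count-pairs {n} p = trans (count-concatMap p (λ i → map (i ,_) (allFin n)) id) (sum-cong-≗ λ i →
  trans (cong (count p) (map-tabulate id (i ,_))) (count-tabulate p (i ,_)))

∑∑-cong : ∀ {n} {f g : Fin n → Fin n → ℕ} → (∀ i j → f i j ≡ g i j) →
  ∑[ i < n ] ∑[ j < n ] f i j ≡ ∑[ i < n ] ∑[ j < n ] g i j
∑∑-cong f≗g = sum-cong-≗ λ i → sum-cong-≗ (f≗g i)

∑-ones : ∀ n → ∑[ i < n ] 1 ≡ n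
∑-ones zero    = refl
∑-ones (suc n) = cong suc (∑-ones n)

∑-indicator : ∀ {n} (v : Fin n) → ∑[ j < n ] iverson (does (j ≟ v)) ≡ 1
∑-indicator {suc n} zero    = cong suc (sum-replicate-zero n)
∑-indicator {suc n} (suc v) = ∑-indicator v

∑-indicator² : ∀ {n} (u v : Fin n) → ∑[ i < n ] ∑[ j < n ] iverson (does (i ≟ u) ∧ does (j ≟ v)) ≡ 1
∑-indicator² {n} u v = trans (sum-cong-≗ row) (∑-indicator u)
  where
  row : ∀ i → ∑[ j < n ] iverson (does (i ≟ u) ∧ does (j ≟ v)) ≡ iverson (does (i ≟ u))
  row i with does (i ≟ u)
  ... | true  = ∑-indicator v
  ... | false = sum-replicate-zero n

∑-<ᵇ : ∀ n → ∑[ i < n ] ∑[ j < n ] iverson (toℕ i <ᵇ toℕ j) ≡ n C 2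
∑-<ᵇ zero    = refl
∑-<ᵇ (suc n) = begin
  -- row 0 has n entries above the diagonal, the other rows form the same sum for n
  ∑[ j < n ] 1 + ∑[ i < n ] ∑[ j < n ] iverson (toℕ i <ᵇ toℕ j)
    ≡⟨ cong₂ _+_ (∑-ones n) (∑-<ᵇ n) ⟩
  n + n C 2
    ≡⟨ cong (_+ n C 2) (nC1≡n n) ⟨
  n C 1 + n C 2
    ≡⟨ nCk+nC[k+1]≡[n+1]C[k+1] n 1 ⟩
  suc n C 2
    ∎
  where open ≡-Reasoning

witness : ∀ {A : Set} (a? : Dec A) → does a? ≡ true → A
witness (yes a) _  = a
witness (no _)  ()

∧-true : ∀ {x y} → x ∧ y ≡ true → x ≡ true × y ≡ true
∧-true {true} y≡true = refl , y≡true

∨-true : ∀ {x y} → x ∨ y ≡ true → x ≡ true ⊎ y ≡ true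
∨-true {true}  _      = inj₁ refl
∨-true {false} y≡true = inj₂ y≡true

iverson-∧-not : ∀ g s → (s ≡ true → g ≡ true) → iverson g ≡ iverson (g ∧ not s) + iverson s
iverson-∧-not true  true  _ = refl
iverson-∧-not true  false _ = refl
iverson-∧-not false true  s⇒g with () ← s⇒g refl
iverson-∧-not false false _ = refl

iverson-∨ : ∀ g s → (s ≡ true → g ≡ false) → iverson (g ∨ s) ≡ iverson g + iverson s
iverson-∨ true  true  s⇒¬g with () ← s⇒¬g refl
iverson-∨ true  false _ = refl
iverson-∨ false s     _ = refl

module _ {n : ℕ} where

  Joins : Fin n → Fin n → Fin n → Fin n → Set
  Joins u v i j = (i ≡ u × j ≡ v) ⊎ (i ≡ v × j ≡ u)

  joins? : ∀ u v i j → Dec (Joins u v i j)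
  joins? u v i j = (i ≟ u ×-dec j ≟ v) ⊎-dec (i ≟ v ×-dec j ≟ u)

  joins : Fin n → Fin n → Fin n → Fin n → Bool
  joins u v i j = does (joins? u v i j)

  Joins-sym : ∀ {u v i j} → Joins u v i j → Joins u v j i
  Joins-sym (inj₁ (i≡u , j≡v)) = inj₂ (j≡v , i≡u)
  Joins-sym (inj₂ (i≡v , j≡u)) = inj₁ (j≡u , i≡v)

  joins-sym : ∀ u v i j → joins u v i j ≡ joins u v j i
  joins-sym u v i j = does-⇔ (mk⇔ Joins-sym Joins-sym) (joins? u v i j) (joins? u v j i)

  joins-irrefl : ∀ {u v} → u ≢ v → ∀ i → joins u v i i ≡ false
  joins-irrefl u≢v i = dec-false (joins? _ _ i i) λ
    { (inj₁ (refl , refl)) → u≢v refl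
    ; (inj₂ (refl , refl)) → u≢v refl
    }

  singleEdge : {u v : Fin n} → u ≢ v → Graph n
  singleEdge {u} {v} u≢v = record
    { adj    = joins u v
    ; sym    = joins-sym u v
    ; irrefl = joins-irrefl u≢v
    }

  removeEdge : Graph n → Fin n → Fin n → Graph n
  removeEdge G u v = record
    { adj    = λ i j → adj G i j ∧ not (joins u v i j)
    ; sym    = λ i j → cong₂ (λ g s → g ∧ not s) (Graph.sym G i j) (joins-sym u v i j)
    ; irrefl = λ i → cong (_∧ not (joins u v i i)) (irrefl G i)
    }

  addEdge : (G : Graph n) {u v : Fin n} → u ≢ v → Graph n
  addEdge G {u} {v} u≢v = record
    { adj    = λ i j → adj G i j ∨ joins u v i j
    ; sym    = λ i j → cong₂ _∨_ (Graph.sym G i j) (joins-sym u v i j)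
    ; irrefl = λ i → cong₂ _∨_ (irrefl G i) (joins-irrefl u≢v i)
    }

complete : (n : ℕ) → Graph n
complete n = record
  { adj    = λ i j → does (¬? (i ≟ j))
  ; sym    = λ i j → does-⇔ (mk⇔ (_∘ sym) (_∘ sym)) (¬? (i ≟ j)) (¬? (j ≟ i))
  ; irrefl = λ i → dec-false (¬? (i ≟ i)) (λ i≢i → i≢i refl)
  }

module _ {n : ℕ} where

  adj⇒≢ : (G : Graph n) {u v : Fin n} → adj G u v ≡ true → u ≢ v
  adj⇒≢ G {u} uv refl with () ← trans (sym (irrefl G u)) uv

  Joins-adj : (G : Graph n) {u v i j : Fin n} {b : Bool} → adj G u v ≡ b → Joins u v i j → adj G i j ≡ b
  Joins-adj G uv (inj₁ (refl , refl)) = uv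
  Joins-adj G {u} {v} uv (inj₂ (refl , refl)) = trans (Graph.sym G v u) uv

  edgeTest : Graph n → Fin n × Fin n → Bool
  edgeTest G (i , j) = (toℕ i <ᵇ toℕ j) ∧ adj G i j

  edgeIndicator : Graph n → Fin n → Fin n → ℕ
  edgeIndicator G i j = iverson (edgeTest G (i , j))

  edgeCount-∑ : (G : Graph n) → edgeCount G ≡ ∑[ i < n ] ∑[ j < n ] edgeIndicator G i j
  edgeCount-∑ G = count-pairs (edgeTest G)

  edge-exists : (G : Graph n) → 0 < edgeCount G → ∃₂ λ u v → adj G u v ≡ true
  edge-exists G positive with count-positive (edgeTest G) (pairs n) positive
  ... | (u , v) , uv = u , v , proj₂ (∧-true uv)

  edgeCount-cong : (G H : Graph n) → (∀ i j → adj G i j ≡ adj H i j) → edgeCount G ≡ edgeCount H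
  edgeCount-cong G H G≐H = begin
    edgeCount G
      ≡⟨ edgeCount-∑ G ⟩
    ∑[ i < n ] ∑[ j < n ] edgeIndicator G i j
      ≡⟨ ∑∑-cong {n} (λ i j → cong (λ g → iverson ((toℕ i <ᵇ toℕ j) ∧ g)) (G≐H i j)) ⟩
    ∑[ i < n ] ∑[ j < n ] edgeIndicator H i j
      ≡⟨ edgeCount-∑ H ⟨
    edgeCount H
      ∎
    where open ≡-Reasoning

  edgeCount-partition : (G G₁ G₂ : Graph n) →
    (∀ i j → iverson (adj G i j) ≡ iverson (adj G₁ i j) + iverson (adj G₂ i j)) →
    edgeCount G ≡ edgeCount G₁ + edgeCount G₂
  edgeCount-partition G G₁ G₂ split = begin
    edgeCount G
      ≡⟨ edgeCount-∑ G ⟩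
    ∑[ i < n ] ∑[ j < n ] edgeIndicator G i j
      ≡⟨ ∑∑-cong {n} (λ i j → restrict (toℕ i <ᵇ toℕ j) (split i j)) ⟩
    ∑[ i < n ] ∑[ j < n ] (edgeIndicator G₁ i j + edgeIndicator G₂ i j)
      ≡⟨ sum-cong-≗ (λ i → ∑-distrib-+ (edgeIndicator G₁ i) (edgeIndicator G₂ i)) ⟩
    ∑[ i < n ] (∑[ j < n ] edgeIndicator G₁ i j + ∑[ j < n ] edgeIndicator G₂ i j)
      ≡⟨ ∑-distrib-+ (λ i → ∑[ j < n ] edgeIndicator G₁ i j) (λ i → ∑[ j < n ] edgeIndicator G₂ i j) ⟩
    ∑[ i < n ] ∑[ j < n ] edgeIndicator G₁ i j + ∑[ i < n ] ∑[ j < n ] edgeIndicator G₂ i j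
      ≡⟨ cong₂ _+_ (edgeCount-∑ G₁) (edgeCount-∑ G₂) ⟨
    edgeCount G₁ + edgeCount G₂
      ∎
    where
    open ≡-Reasoning
    restrict : ∀ β {g g₁ g₂} → iverson g ≡ iverson g₁ + iverson g₂ →
      iverson (β ∧ g) ≡ iverson (β ∧ g₁) + iverson (β ∧ g₂)
    restrict true  g≡g₁+g₂ = g≡g₁+g₂
    restrict false _       = refl

  edgeCount-complete : edgeCount (complete n) ≡ n C 2
  edgeCount-complete = begin
    edgeCount (complete n)
      ≡⟨ edgeCount-∑ (complete n) ⟩
    ∑[ i < n ] ∑[ j < n ] edgeIndicator (complete n) i j
      ≡⟨ ∑∑-cong {n} (λ i j → cong iverson (below-diagonal i j)) ⟩
    ∑[ i < n ] ∑[ j < n ] iverson (toℕ i <ᵇ toℕ j)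
      ≡⟨ ∑-<ᵇ n ⟩
    n C 2
      ∎
    where
    open ≡-Reasoning
    below-diagonal : ∀ i j → does ((toℕ i <? toℕ j) ×-dec ¬? (i ≟ j)) ≡ does (toℕ i <? toℕ j)
    below-diagonal i j = does-⇔ (mk⇔ proj₁ (λ i<j → i<j , λ { refl → <-irrefl refl i<j }))
      ((toℕ i <? toℕ j) ×-dec ¬? (i ≟ j)) (toℕ i <? toℕ j)

  edgeCount-singleEdge-< : {u v : Fin n} (u≢v : u ≢ v) → toℕ u < toℕ v → edgeCount (singleEdge u≢v) ≡ 1
  edgeCount-singleEdge-< {u} {v} u≢v u<v = begin
    edgeCount (singleEdge u≢v)
      ≡⟨ edgeCount-∑ (singleEdge u≢v) ⟩
    ∑[ i < n ] ∑[ j < n ] edgeIndicator (singleEdge u≢v) i j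
      ≡⟨ ∑∑-cong {n} (λ i j → cong iverson (only-uv i j)) ⟩
    ∑[ i < n ] ∑[ j < n ] iverson (does (i ≟ u) ∧ does (j ≟ v))
      ≡⟨ ∑-indicator² u v ⟩
    1
      ∎
    where
    open ≡-Reasoning
    only-uv : ∀ i j → does ((toℕ i <? toℕ j) ×-dec joins? u v i j) ≡ does (i ≟ u ×-dec j ≟ v)
    only-uv i j = does-⇔ (mk⇔ to (λ { (refl , refl) → u<v , inj₁ (refl , refl) }))
      ((toℕ i <? toℕ j) ×-dec joins? u v i j) (i ≟ u ×-dec j ≟ v)
      where
      to : toℕ i < toℕ j × Joins u v i j → i ≡ u × j ≡ v
      to (_   , inj₁ i≡u×j≡v)       = i≡u×j≡v
      to (v<u , inj₂ (refl , refl)) = ⊥-elim (<-asym u<v v<u)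

  edgeCount-singleEdge : {u v : Fin n} (u≢v : u ≢ v) → edgeCount (singleEdge u≢v) ≡ 1
  edgeCount-singleEdge {u} {v} u≢v with <-cmp (toℕ u) (toℕ v)
  ... | tri< u<v _ _ = edgeCount-singleEdge-< u≢v u<v
  ... | tri≈ _ u≡v _ = ⊥-elim (u≢v (toℕ-injective u≡v))
  ... | tri> _ _ v<u = trans (edgeCount-cong (singleEdge u≢v) (singleEdge (u≢v ∘ sym))
                               λ i j → does-⇔ (mk⇔ swap swap) (joins? u v i j) (joins? v u i j))
                             (edgeCount-singleEdge-< (u≢v ∘ sym) v<u)

  edgeCount-removeEdge : (G : Graph n) {u v : Fin n} → adj G u v ≡ true →
    edgeCount G ≡ suc (edgeCount (removeEdge G u v))
  edgeCount-removeEdge G {u} {v} uv = begin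
    edgeCount G
      ≡⟨ edgeCount-partition G (removeEdge G u v) (singleEdge u≢v) split ⟩
    edgeCount (removeEdge G u v) + edgeCount (singleEdge u≢v)
      ≡⟨ cong (edgeCount (removeEdge G u v) +_) (edgeCount-singleEdge u≢v) ⟩
    edgeCount (removeEdge G u v) + 1
      ≡⟨ +-comm _ 1 ⟩
    suc (edgeCount (removeEdge G u v))
      ∎
    where
    open ≡-Reasoning
    u≢v = adj⇒≢ G uv
    split : ∀ i j → iverson (adj G i j) ≡ iverson (adj (removeEdge G u v) i j) + iverson (joins u v i j)
    split i j = iverson-∧-not (adj G i j) (joins u v i j) (Joins-adj G uv ∘ witness (joins? u v i j))

  edgeCount-addEdge : (G : Graph n) {u v : Fin n} (u≢v : u ≢ v) → adj G u v ≡ false →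
    edgeCount (addEdge G u≢v) ≡ suc (edgeCount G)
  edgeCount-addEdge G {u} {v} u≢v ¬uv = begin
    edgeCount (addEdge G u≢v)
      ≡⟨ edgeCount-partition (addEdge G u≢v) G (singleEdge u≢v) split ⟩
    edgeCount G + edgeCount (singleEdge u≢v)
      ≡⟨ cong (edgeCount G +_) (edgeCount-singleEdge u≢v) ⟩
    edgeCount G + 1
      ≡⟨ +-comm _ 1 ⟩
    suc (edgeCount G)
      ∎
    where
    open ≡-Reasoning
    split : ∀ i j → iverson (adj (addEdge G u≢v) i j) ≡ iverson (adj G i j) + iverson (joins u v i j)
    split i j = iverson-∨ (adj G i j) (joins u v i j) (Joins-adj G ¬uv ∘ witness (joins? u v i j))

module _ {n : ℕ} (G : Graph n) where

  removeEdge-adj⁺ : ∀ {u v i j} → adj G i j ≡ true → ¬ Joins u v i j →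
    adj (removeEdge G u v) i j ≡ true
  removeEdge-adj⁺ {u} {v} {i} {j} ij ¬uvij rewrite ij | dec-false (joins? u v i j) ¬uvij = refl

  removeEdge-adj⁻ : ∀ {u v i j} → adj (removeEdge G u v) i j ≡ true →
    adj G i j ≡ true × ¬ Joins u v i j
  removeEdge-adj⁻ {u} {v} {i} {j} ij with ∧-true {adj G i j} ij
  ... | ij′ , ¬uv = ij′ , λ uvij → case trans (sym ¬uv) (cong not (dec-true (joins? u v i j) uvij)) of λ ()

  addEdge-adj⁺ : ∀ {u v i j} (u≢v : u ≢ v) → adj G i j ≡ true ⊎ Joins u v i j →
    adj (addEdge G u≢v) i j ≡ true
  addEdge-adj⁺ _ (inj₁ ij) rewrite ij = refl
  addEdge-adj⁺ {u} {v} {i} {j} _ (inj₂ uvij) rewrite dec-true (joins? u v i j) uvij = Bool.∨-zeroʳ (adj G i j)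

  addEdge-adj⁻ : ∀ {u v i j} (u≢v : u ≢ v) → adj (addEdge G u≢v) i j ≡ true →
    adj G i j ≡ true ⊎ Joins u v i j
  addEdge-adj⁻ {u} {v} {i} {j} _ ij = Sum.map₂ (witness (joins? u v i j)) (∨-true {adj G i j} ij)

  nonIsolatedˡ : ∀ {u v} → adj G u v ≡ true → NonIsolated G u
  nonIsolatedˡ {v = v} uv = v , uv

  nonIsolatedʳ : ∀ {u v} → adj G u v ≡ true → NonIsolated G v
  nonIsolatedʳ {u} {v} uv = u , trans (Graph.sym G v u) uv

Isolated : ∀ {n} → Graph n → Fin n → Set
Isolated G v = ¬ NonIsolated G v

module _ {n : ℕ} (G : Graph n) where

  nonIsolated? : Decidable (NonIsolated G)
  nonIsolated? v = any? λ w → adj G v w Bool.≟ true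

  isolated? : Decidable (Isolated G)
  isolated? = ¬? ∘ nonIsolated?

module _ {n : ℕ} (G : Graph n) (nic : NonIsolatedComplete G) where

  edgeCount-withoutIsolated : (∀ v → NonIsolated G v) → edgeCount G ≡ n C 2
  edgeCount-withoutIsolated nonIsolated = trans (edgeCount-cong G (complete n) same) (edgeCount-complete {n})
    where
    same : ∀ i j → adj G i j ≡ adj (complete n) i j
    same i j with i ≟ j
    ... | yes refl = irrefl G i
    ... | no i≢j   = nic i j (nonIsolated i) (nonIsolated j) i≢j

  edgeCount-onlyEdge : ∀ {a b} → adj G a b ≡ true → (∀ x → adj G a x ≡ true → x ≡ b) →
    edgeCount G ≡ 1
  edgeCount-onlyEdge {a} {b} ab onlyNeighbour =
    trans (edgeCount-cong G (singleEdge (adj⇒≢ G ab)) same) (edgeCount-singleEdge (adj⇒≢ G ab))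
    where
    endpoint : ∀ {v} → NonIsolated G v → v ≡ a ⊎ v ≡ b
    endpoint {v} nv with v ≟ a
    ... | yes v≡a = inj₁ v≡a
    ... | no v≢a  = inj₂ (onlyNeighbour v (nic a v (b , ab) nv (v≢a ∘ sym)))
    edge-joins : ∀ {i j} → adj G i j ≡ true → Joins a b i j
    edge-joins ij with endpoint (nonIsolatedˡ G ij) | endpoint (nonIsolatedʳ G ij)
    ... | inj₁ i≡a  | inj₂ j≡b  = inj₁ (i≡a , j≡b)
    ... | inj₂ i≡b  | inj₁ j≡a  = inj₂ (i≡b , j≡a)
    ... | inj₁ refl | inj₁ refl = ⊥-elim (adj⇒≢ G ij refl)
    ... | inj₂ refl | inj₂ refl = ⊥-elim (adj⇒≢ G ij refl)
    same : ∀ i j → adj G i j ≡ joins a b i j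
    same i j with joins? a b i j
    ... | yes abij = trans (Joins-adj G ab abij) (sym (dec-true (joins? a b i j) abij))
    ... | no ¬abij = trans (Bool.¬-not (¬abij ∘ edge-joins)) (sym (dec-false (joins? a b i j) ¬abij))

  isolated-exists : edgeCount G < n C 2 → ∃ (Isolated G)
  isolated-exists fewEdges with any? (isolated? G)
  ... | yes found = found
  ... | no none   = ⊥-elim (<-irrefl (edgeCount-withoutIsolated nonIsolated) fewEdges)
    where
    nonIsolated : ∀ v → NonIsolated G v
    nonIsolated v = decidable-stable (nonIsolated? G v) (λ isolated → none (v , isolated))

  second-neighbour : ∀ {a b} → adj G a b ≡ true → 1 < edgeCount G →
    ∃ λ x → adj G a x ≡ true × x ≢ b
  second-neighbour {a} {b} ab manyEdges with any? (λ x → (adj G a x Bool.≟ true) ×-dec ¬? (x ≟ b))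
  ... | yes found = found
  ... | no none   = ⊥-elim (<-irrefl (sym (edgeCount-onlyEdge ab onlyNeighbour)) manyEdges)
    where
    onlyNeighbour : ∀ x → adj G a x ≡ true → x ≡ b
    onlyNeighbour x ax = decidable-stable (x ≟ b) (λ x≢b → none (x , ax , x≢b))

subsetOf : ∀ {n} {P : Pred (Fin n) 0ℓ} → Decidable P → Subset n
subsetOf P? = Vec.tabulate (does ∘ P?)

module _ {n} {P : Pred (Fin n) 0ℓ} (P? : Decidable P) where

  ∈-subsetOf⁺ : ∀ {v} → P v → v ∈ subsetOf P?
  ∈-subsetOf⁺ {v} pv = Vec.lookup⇒[]= v _ (trans (Vec.lookup∘tabulate (does ∘ P?) v) (dec-true (P? v) pv))

  ∈-subsetOf⁻ : ∀ {v} → v ∈ subsetOf P? → P v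
  ∈-subsetOf⁻ {v} v∈ = witness (P? v) (trans (sym (Vec.lookup∘tabulate (does ∘ P?) v)) (Vec.[]=⇒lookup v∈))

cliqueCover : ∀ {n k} (G : Graph n) {Member : Fin k → Pred (Fin n) 0ℓ} → (∀ l → Decidable (Member l)) →
  (∀ l i j → Member l i → Member l j → i ≢ j → adj G i j ≡ true) →
  (∀ v → ∃ λ l → Member l v) →
  (∀ {u v} → adj G u v ≡ true → ∃ λ l → Member l u × Member l v) →
  HasCliqueCoverOfSize G k
cliqueCover G {Member} member? isClique covers coversEdges =
  cover ,
  (λ l i j i∈ j∈ → isClique l i j (∈⁻ l i∈) (∈⁻ l j∈)) ,
  (λ v → let l , v∈ = covers v in l , ∈⁺ l v∈) ,
  (λ u v uv → let l , u∈ , v∈ = coversEdges uv in l , ∈⁺ l u∈ , ∈⁺ l v∈)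
  where
  cover = Vec.tabulate (subsetOf ∘ member?)
  ∈⁺ : ∀ l {v} → Member l v → v ∈ Vec.lookup cover l
  ∈⁺ l m = subst (_ ∈_) (sym (Vec.lookup∘tabulate (subsetOf ∘ member?) l)) (∈-subsetOf⁺ (member? l) m)
  ∈⁻ : ∀ l {v} → v ∈ Vec.lookup cover l → Member l v
  ∈⁻ l v∈ = ∈-subsetOf⁻ (member? l) (subst (_ ∈_) (Vec.lookup∘tabulate (subsetOf ∘ member?) l) v∈)

module _ {n} (G : Graph n) where

  Apart : Fin n → Fin n → Set
  Apart p q = p ≢ q × adj G p q ≢ true

  apart-sym : ∀ {p q} → Apart p q → Apart q p
  apart-sym {p} {q} (p≢q , ¬pq) = p≢q ∘ sym , ¬pq ∘ trans (Graph.sym G p q)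

  clique-apart : ∀ {S p q} → IsClique G S → p ∈ S → q ∈ S → ¬ Apart p q
  clique-apart clique p∈ q∈ (p≢q , ¬pq) = ¬pq (clique _ _ p∈ q∈ p≢q)

  -- The members covering ax, bx and each e l are pairwise different.
  cover-lowerBound : ∀ {ℓ m a b x} {e : Fin ℓ → Fin n} →
    adj G a x ≡ true → adj G b x ≡ true → Apart a b →
    (∀ l → Apart x (e l)) → (∀ {l l′} → l ≢ l′ → Apart (e l) (e l′)) →
    HasCliqueCoverOfSize G m → 2 + ℓ ≤ m
  cover-lowerBound {ℓ} {a = a} {b} {x} {e} ax bx a-b x-e e-e (cover , isClique , covers , coversEdges) =
    injective⇒≤ clique-injective
    where
    sharing : ∀ {c c′ p q} → c ≡ c′ →
      p ∈ Vec.lookup cover c → q ∈ Vec.lookup cover c′ → ¬ Apart p q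
    sharing {c} refl = clique-apart (isClique c)
    ax-clique = coversEdges a x ax
    bx-clique = coversEdges b x bx
    e-clique = λ l → covers (e l)
    clique : Fin (2 + ℓ) → Fin _
    clique zero          = proj₁ ax-clique
    clique (suc zero)    = proj₁ bx-clique
    clique (suc (suc l)) = proj₁ (e-clique l)
    a∈ = proj₁ (proj₂ ax-clique)
    b∈ = proj₁ (proj₂ bx-clique)
    x∈₀ = proj₂ (proj₂ ax-clique)
    x∈₁ = proj₂ (proj₂ bx-clique)
    e∈ = λ l → proj₂ (e-clique l)
    clique-injective : Injective _≡_ _≡_ clique
    clique-injective {zero}        {zero}         _  = refl
    clique-injective {zero}        {suc zero}     eq = ⊥-elim (sharing eq a∈ b∈ a-b)
    clique-injective {zero}        {suc (suc l)}  eq = ⊥-elim (sharing eq x∈₀ (e∈ l) (x-e l))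
    clique-injective {suc zero}    {zero}         eq = ⊥-elim (sharing eq b∈ a∈ (apart-sym a-b))
    clique-injective {suc zero}    {suc zero}     _  = refl
    clique-injective {suc zero}    {suc (suc l)}  eq = ⊥-elim (sharing eq x∈₁ (e∈ l) (x-e l))
    clique-injective {suc (suc l)} {zero}         eq = ⊥-elim (sharing eq (e∈ l) x∈₀ (apart-sym (x-e l)))
    clique-injective {suc (suc l)} {suc zero}     eq = ⊥-elim (sharing eq (e∈ l) x∈₁ (apart-sym (x-e l)))
    clique-injective {suc (suc l)} {suc (suc l′)} eq with l ≟ l′
    ... | yes refl = refl
    ... | no l≢l′  = ⊥-elim (sharing eq (e∈ l) (e∈ l′) (e-e l≢l′))

lookup-injective : ∀ {A : Set} {xs : List A} → Unique xs → Injective _≡_ _≡_ (lookup xs)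
lookup-injective {xs = _ ∷ _} _           {zero}  {zero}  _  = refl
lookup-injective {xs = _ ∷ _} (x∉ ∷ _)   {zero}  {suc j} eq = ⊥-elim (All.lookup x∉ (∈-lookup j) eq)
lookup-injective {xs = _ ∷ _} (x∉ ∷ _)   {suc i} {zero}  eq = ⊥-elim (All.lookup x∉ (∈-lookup i) (sym eq))
lookup-injective {xs = _ ∷ _} (_ ∷ unique) {suc i} {suc j} eq = cong suc (lookup-injective unique eq)

record Enumeration {n} (P : Pred (Fin n) 0ℓ) : Set where
  field
    size              : ℕ
    element           : Fin size → Fin n
    element-injective : Injective _≡_ _≡_ element
    element-sound     : ∀ l → P (element l)
    element-complete  : ∀ {v} → P v → ∃ λ l → element l ≡ v

enumerate : ∀ {n} {P : Pred (Fin n) 0ℓ} → Decidable P → Enumeration P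
enumerate {n} P? = record
  { size              = length xs
  ; element           = lookup xs
  ; element-injective = lookup-injective (Unique.filter⁺ P? (Unique.allFin⁺ n))
  ; element-sound     = λ l → All.lookup (all-filter P? (allFin n)) (∈-lookup l)
  ; element-complete  = λ pv → let v∈ = ∈-filter⁺ P? (∈-allFin _) pv in index v∈ , sym (lookup-index v∈)
  }
  where
  xs = filter P? (allFin n)

isolatedVertices : ∀ {n} (G : Graph n) → Enumeration (Isolated G)
isolatedVertices G = enumerate (isolated? G)

isolatedCount : ∀ {n} → Graph n → ℕ
isolatedCount G = Enumeration.size (isolatedVertices G)

cover-isolatedSingletons : ∀ {n} (G : Graph n) → NonIsolatedComplete G → (E : Enumeration (Isolated G)) →
  HasCliqueCoverOfSize G (suc (Enumeration.size E))
cover-isolatedSingletons G nic E =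
  cliqueCover G member? isClique covers (λ uv → zero , nonIsolatedˡ G uv , nonIsolatedʳ G uv)
  where
  open Enumeration E
  Member : Fin (suc size) → Pred (Fin _) 0ℓ
  Member zero    = NonIsolated G
  Member (suc l) = _≡ element l
  member? : ∀ l → Decidable (Member l)
  member? zero      = nonIsolated? G
  member? (suc l) v = v ≟ element l
  isClique : ∀ l i j → Member l i → Member l j → i ≢ j → adj G i j ≡ true
  isClique zero    = nic
  isClique (suc l) i j refl refl i≢j = ⊥-elim (i≢j refl)
  covers : ∀ v → ∃ λ l → Member l v
  covers v with nonIsolated? G v
  ... | yes nonIsolated = zero , nonIsolated
  ... | no isolated     = let l , l↦v = element-complete isolated in suc l , sym l↦v

-- Moving the edge ab to ac

module Switch {n} (G : Graph n) (nic : NonIsolatedComplete G) {a b c : Fin n}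
  (ab : adj G a b ≡ true) (c-isolated : Isolated G c) where

  a≢b : a ≢ b
  a≢b = adj⇒≢ G ab

  a≢c : a ≢ c
  a≢c refl = c-isolated (nonIsolatedˡ G ab)

  b≢c : b ≢ c
  b≢c refl = c-isolated (nonIsolatedʳ G ab)

  switched : Graph n
  switched = addEdge (removeEdge G a b) a≢c

  edgeCount-switched : edgeCount switched ≡ edgeCount G
  edgeCount-switched = begin
    edgeCount switched                    ≡⟨ edgeCount-addEdge (removeEdge G a b) a≢c ac-absent ⟩
    suc (edgeCount (removeEdge G a b))    ≡⟨ edgeCount-removeEdge G ab ⟨
    edgeCount G                           ∎
    where
    open ≡-Reasoning
    ac-absent : adj (removeEdge G a b) a c ≡ false
    ac-absent = Bool.¬-not (c-isolated ∘ nonIsolatedʳ G ∘ proj₁ ∘ removeEdge-adj⁻ G)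

  switched-adj : ∀ {u v} → NonIsolated G u → NonIsolated G v → u ≢ v → ¬ Joins a b u v →
    adj switched u v ≡ true
  switched-adj {u} {v} nu nv u≢v ¬abuv =
    addEdge-adj⁺ (removeEdge G a b) a≢c (inj₁ (removeEdge-adj⁺ G (nic u v nu nv u≢v) ¬abuv))

  switched-ac : adj switched a c ≡ true
  switched-ac = addEdge-adj⁺ (removeEdge G a b) a≢c (inj₂ (inj₁ (refl , refl)))

  switched-ca : adj switched c a ≡ true
  switched-ca = addEdge-adj⁺ (removeEdge G a b) a≢c (inj₂ (inj₂ (refl , refl)))

  switched-¬ab : adj switched a b ≢ true
  switched-¬ab ab′ with addEdge-adj⁻ (removeEdge G a b) a≢c ab′
  ... | inj₁ ab″                = proj₂ (removeEdge-adj⁻ G ab″) (inj₁ (refl , refl))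
  ... | inj₂ (inj₁ (_ , b≡c))   = b≢c b≡c
  ... | inj₂ (inj₂ (a≡c , _))   = a≢c a≡c

  switched-isolated : ∀ {v w} → Isolated G v → adj switched v w ≡ true → w ≡ a
  switched-isolated v-isolated vw with addEdge-adj⁻ (removeEdge G a b) a≢c vw
  ... | inj₁ vw′               = ⊥-elim (v-isolated (nonIsolatedˡ G (proj₁ (removeEdge-adj⁻ G vw′))))
  ... | inj₂ (inj₁ (refl , _)) = ⊥-elim (v-isolated (nonIsolatedˡ G ab))
  ... | inj₂ (inj₂ (_ , w≡a))  = w≡a

  open Enumeration (isolatedVertices G)

  cover-switched : HasCliqueCoverOfSize switched (2 + size)
  cover-switched = cliqueCover switched member? isClique covers coversEdges
    where
    Member : Fin (2 + size) → Pred (Fin n) 0ℓ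
    Member zero          v = NonIsolated G v × v ≢ a
    Member (suc zero)    v = NonIsolated G v × v ≢ b
    Member (suc (suc l)) v = v ≡ element l ⊎ (element l ≡ c × v ≡ a)
    member? : ∀ l → Decidable (Member l)
    member? zero          v = nonIsolated? G v ×-dec ¬? (v ≟ a)
    member? (suc zero)    v = nonIsolated? G v ×-dec ¬? (v ≟ b)
    member? (suc (suc l)) v = v ≟ element l ⊎-dec (element l ≟ c ×-dec v ≟ a)
    isClique : ∀ l i j → Member l i → Member l j → i ≢ j → adj switched i j ≡ true
    isClique zero       i j (ni , i≢a) (nj , j≢a) i≢j =
      switched-adj ni nj i≢j [ i≢a ∘ proj₁ , j≢a ∘ proj₂ ]
    isClique (suc zero) i j (ni , i≢b) (nj , j≢b) i≢j =
      switched-adj ni nj i≢j [ j≢b ∘ proj₂ , i≢b ∘ proj₁ ]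
    isClique (suc (suc l)) i j (inj₁ refl)         (inj₂ (refl , refl)) _   = switched-ca
    isClique (suc (suc l)) i j (inj₂ (refl , refl)) (inj₁ refl)         _   = switched-ac
    isClique (suc (suc l)) i j (inj₁ refl)         (inj₁ refl)         i≢j = ⊥-elim (i≢j refl)
    isClique (suc (suc l)) i j (inj₂ (_ , refl))   (inj₂ (_ , refl))   i≢j = ⊥-elim (i≢j refl)
    covers : ∀ v → ∃ λ l → Member l v
    covers v with nonIsolated? G v | v ≟ a
    ... | no isolated     | _        = let l , l↦v = element-complete isolated in suc (suc l) , inj₁ (sym l↦v)
    ... | yes nonIsolated | yes refl = suc zero , nonIsolated , a≢b
    ... | yes nonIsolated | no v≢a   = zero , nonIsolated , v≢a
    coversEdgesOfG : ∀ {u v} → adj G u v ≡ true → ¬ Joins a b u v → ∃ λ l → Member l u × Member l v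
    coversEdgesOfG {u} {v} uv ¬abuv with u ≟ a | v ≟ a
    ... | yes refl | yes refl = ⊥-elim (adj⇒≢ G uv refl)
    ... | yes refl | no v≢a   =
      suc zero , (nonIsolatedˡ G uv , a≢b) , (nonIsolatedʳ G uv , λ v≡b → ¬abuv (inj₁ (refl , v≡b)))
    ... | no u≢a   | yes refl =
      suc zero , (nonIsolatedˡ G uv , λ u≡b → ¬abuv (inj₂ (u≡b , refl))) , (nonIsolatedʳ G uv , a≢b)
    ... | no u≢a   | no v≢a   = zero , (nonIsolatedˡ G uv , u≢a) , (nonIsolatedʳ G uv , v≢a)
    c-clique : ∃ λ l → element l ≡ c
    c-clique = element-complete c-isolated
    coversEdges : ∀ {u v} → adj switched u v ≡ true → ∃ λ l → Member l u × Member l v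
    coversEdges uv with addEdge-adj⁻ (removeEdge G a b) a≢c uv
    ... | inj₁ uv′                  = let uv″ , ¬abuv = removeEdge-adj⁻ G uv′ in coversEdgesOfG uv″ ¬abuv
    ... | inj₂ (inj₁ (refl , refl)) =
      suc (suc (proj₁ c-clique)) , inj₂ (proj₂ c-clique , refl) , inj₁ (sym (proj₂ c-clique))
    ... | inj₂ (inj₂ (refl , refl)) =
      suc (suc (proj₁ c-clique)) , inj₁ (sym (proj₂ c-clique)) , inj₂ (proj₂ c-clique , refl)

  θ-switched : ∀ {x} → adj G a x ≡ true → x ≢ b → IsTheta switched (2 + size)
  θ-switched {x} ax x≢b =
    cover-switched , λ _ → cover-lowerBound switched ax′ bx′ (a≢b , switched-¬ab) x-apart e-apart
    where
    x≢a : x ≢ a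
    x≢a = adj⇒≢ G ax ∘ sym
    ax′ : adj switched a x ≡ true
    ax′ = switched-adj (nonIsolatedˡ G ab) (nonIsolatedʳ G ax) (x≢a ∘ sym)
      [ x≢b ∘ proj₂ , x≢a ∘ proj₂ ]
    bx′ : adj switched b x ≡ true
    bx′ = switched-adj (nonIsolatedʳ G ab) (nonIsolatedʳ G ax) (x≢b ∘ sym)
      [ a≢b ∘ sym ∘ proj₁ , x≢a ∘ proj₂ ]
    x-apart : ∀ l → Apart switched x (element l)
    x-apart l = (λ x≡l → element-sound l (subst (NonIsolated G) x≡l (nonIsolatedʳ G ax))) ,
                (λ xl → x≢a (switched-isolated (element-sound l) (trans (Graph.sym switched (element l) x) xl)))
    e-apart : ∀ {l l′} → l ≢ l′ → Apart switched (element l) (element l′)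
    e-apart {l} {l′} l≢l′ = l≢l′ ∘ element-injective , λ ll′ →
      element-sound l′ (subst (NonIsolated G) (sym (switched-isolated (element-sound l) ll′)) (nonIsolatedˡ G ab))

lemma15 : (n m : ℕ) → 4 ≤ n → 1 < m → m < n C 2 →
    (G : Graph n) → edgeCount G ≡ m → NonIsolatedComplete G →
    (k t : ℕ) → IsTheta G k → IsBigTheta n m t → k ≢ t
lemma15 n m _ 1<m m<nC2 G refl nic k t (_ , k-minimal) (_ , t-maximal) refl =
  let a , b , ab     = edge-exists G (<-trans (s≤s z≤n) 1<m)
      c , c-isolated = isolated-exists G nic m<nC2
      x , ax , x≢b   = second-neighbour G nic ab 1<m
      open Switch G nic ab c-isolated
  in <-irrefl refl (begin-strict
       k                      ≤⟨ k-minimal _ (cover-isolatedSingletons G nic (isolatedVertices G)) ⟩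
       suc (isolatedCount G)  <⟨ n<1+n _ ⟩
       2 + isolatedCount G    ≤⟨ t-maximal switched _ edgeCount-switched (θ-switched ax x≢b) ⟩
       k                      ∎)
  where open ≤-Reasoning
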